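{- Let $\mathcal{C}=\langle\ell_0,\ell_1,\dots,\ell_k\rangle$, where $k=1$ or $k\ge3$, be a caterpillar ladder together with a map $\phi$ satisfying (P1), (P2) and (P3$^\downarrow$) with respect to a tree-child network $\mathcal{N}$ on $X$ (i.e. a loose caterpillar ladder $\mathcal{C}_k^\downarrow$ of $\mathcal{N}$), and let $e_j=(\phi(p_j),\phi(v_j))$, $f_j=(\phi(q_j),\phi(v_j))$. If $\mathcal{E}$ and $\mathcal{E}'$ are two embeddings of the same phylogenetic $X$-tree $\mathcal{T}$ in $\mathcal{N}$ such that $\mathcal{E}'$ uses $\{f_1,f_2,\dots,f_k\}$ and $\mathcal{E}$ uses $e_k$, then $\mathcal{E}$ also uses $\{e_1,e_2,\dots,e_{k-1}\}$.
   Context: A (rooted binary) phylogenetic network on a finite nonempty set $X$ is a rooted acyclic directed graph with no parallel arcs such that the root has in-degree 0 and out-degree 2; the leaves (out-degree 0) have in-degree 1 and are exactly the elements of $X$; every other vertex is a tree vertex (in-degree 1, out-degree 2) or a reticulation (in-degree 2, out-degree 1). A tree path is a directed path $v_1,\dots,v_n$ ($n\ge1$) with each of $v_2,\dots,v_n$ a tree vertex or a leaf. The network is tree-child if every non-leaf vertex has a child that is a tree vertex or a leaf. A phylogenetic $X$-tree is a phylogenetic network on $X$ with no reticulations. An embedding of a phylogenetic tree $\mathcal{T}$ in $\mathcal{N}$ is a set of arcs of $\mathcal{N}$ inducing a subdivision of $\mathcal{T}$; it uses the arcs it contains. Caterpillar ladder: for $k\ge1$ and distinct labels $\ell_0,\dots,\ell_k$,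 $\langle\ell_0,\dots,\ell_k\rangle$ has vertices $\ell_0,\dots,\ell_k$ and $v_j,p_j,q_j$ ($1\le j\le k$); arcs: if $k=1$, $(q_1,p_1)$ and $(p_1,\ell_0)$; if $k\ge2$, the arcs of the directed path $q_k,q_{k-1},p_k,q_{k-2},p_{k-1},\dots,q_2,p_3,q_1,p_2,p_1,\ell_0$; and for each $j$, $(p_j,v_j),(q_j,v_j),(v_j,\ell_j)$. The spine is the path $q_k,q_{k-1},p_k,\dots,q_1,p_2,p_1$ (the arc $(q_1,p_1)$ if $k=1$). When $k=1$, $q_0$ denotes $p_1$ and $p_2$ denotes $q_1$. Let $\{\ell_0,\dots,\ell_k\}\subseteq X$ and let $\phi$ be an injective map from the vertices of the ladder to those of $\mathcal{N}$ with $\phi(\ell_j)=\ell_j$. Conditions: (P1) there are tree paths in $\mathcal{N}$ from $\phi(p_1)$ to $\ell_0$ and from $\phi(v_j)$ to $\ell_j$ for each $j\ge1$; (P2) $(\phi(p_j),\phi(v_j))$ and $(\phi(q_j),\phi(v_j))$ are arcs of $\mathcal{N}$ for each $j$; (P3$^\downarrow$) for each spine arc $(u,w)\neq(p_2,p_1)$ there is a tree path from $\phi(u)$ to $\phi(w)$ in $\mathcal{N}$, and there is a directed path from $\phi(p_2)$ to $\phi(p_1)$ in $\mathcal{N}$. -}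

module Defs where

open import Data.Nat using (ℕ; zero; suc; _≤_; _∸_)
open import Data.Fin using (Fin)
open import Data.Bool using (Bool; true)
open import Data.List using (List; []; _∷_; _++_; [_]; length; filterᵇ; allFin)
open import Data.List.Membership.Propositional using (_∈_; _∉_)
open import Data.Product using (_×_; _,_; ∃; ∃-syntax; Σ-syntax)
open import Data.Sum using (_⊎_)
open import Relation.Nullary using (¬_)
open import Relation.Binary.PropositionalEquality using (_≡_; _≢_)
open import Function.Definitions using (Injective)

-- Finite digraphs on vertex set Fin n, given by an adjacency matrix
-- (so there are no parallel arcs by construction).

module Digraph {n : ℕ} (arc : Fin n → Fin n → Bool) where

  Arc : Fin n → Fin n → Set
  Arc u w = arc u w ≡ true

  indeg : Fin n → ℕ
  indeg v = length (filterᵇ (λ u → arc u v) (allFin n))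

  outdeg : Fin n → ℕ
  outdeg v = length (filterᵇ (λ w → arc v w) (allFin n))

  data Reach⁺ : Fin n → Fin n → Set where
    one  : ∀ {u w} → Arc u w → Reach⁺ u w
    more : ∀ {u x w} → Arc u x → Reach⁺ x w → Reach⁺ u w

  data DPath : Fin n → Fin n → Set where
    here : ∀ {u} → DPath u u
    step : ∀ {u x w} → Arc u x → DPath x w → DPath u w

  IsLeaf IsTreeVertex IsReticulation : Fin n → Set
  IsLeaf v         = indeg v ≡ 1 × outdeg v ≡ 0
  IsTreeVertex v   = indeg v ≡ 1 × outdeg v ≡ 2
  IsReticulation v = indeg v ≡ 2 × outdeg v ≡ 1

  data TreePath : Fin n → Fin n → Set where
    here : ∀ {u} → TreePath u u
    step : ∀ {u x w} → Arc u x → (IsTreeVertex x ⊎ IsLeaf x) →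
           TreePath x w → TreePath u w

  Chain : Fin n → List (Fin n) → Fin n → Set
  Chain u []       w = Arc u w
  Chain u (x ∷ xs) w = Arc u x × Chain x xs w

  OnChain : Fin n → List (Fin n) → Fin n → Fin n → Fin n → Set
  OnChain u []       w a b = a ≡ u × b ≡ w
  OnChain u (x ∷ xs) w a b = (a ≡ u × b ≡ x) ⊎ OnChain x xs w a b

record Network (m n : ℕ) : Set where
  field
    arc  : Fin n → Fin n → Bool
    root : Fin n
    leaf : Fin m → Fin n
  open Digraph arc public
  field
    acyclic   : ∀ v → ¬ Reach⁺ v v
    root-deg  : indeg root ≡ 0 × outdeg root ≡ 2
    vertex-kinds : ∀ v → v ≢ root →
                   IsLeaf v ⊎ IsTreeVertex v ⊎ IsReticulation v
    leaf-inj  : Injective _≡_ _≡_ leaf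
    leaf-out  : ∀ x → outdeg (leaf x) ≡ 0
    leaves-X  : ∀ v → outdeg v ≡ 0 → ∃[ x ] leaf x ≡ v

TreeChild : ∀ {m n} → Network m n → Set
TreeChild N = ∀ v → ¬ IsLeaf v →
              ∃[ c ] (Arc v c × (IsTreeVertex c ⊎ IsLeaf c))
  where open Network N

IsPhyloTree : ∀ {m t} → Network m t → Set
IsPhyloTree T = ∀ v → ¬ IsReticulation v
  where open Network T

-- Embedding of a phylogenetic tree T in a network N: a set of arcs of N
-- inducing a (leaf-label preserving) subdivision of T.  A subdivision of T
-- is given by an injective placement ψ of the vertices of T, and, for every
-- arc (a , b) of T, a directed path of N from ψ a to ψ b (its interior
-- vertices listed by `path`), such that distinct arcs get internally
-- vertex-disjoint paths whose interiors avoid the image of ψ.  The arc set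
-- of the embedding is the union of the arcs of these paths.

record Embedding {m n t : ℕ} (T : Network m t) (N : Network m n) : Set where
  private
    module T = Network T
    module N = Network N
  field
    ψ       : Fin t → Fin n
    ψ-inj   : Injective _≡_ _≡_ ψ
    ψ-leaf  : ∀ x → ψ (T.leaf x) ≡ N.leaf x
    path    : ∀ a b → T.Arc a b → List (Fin n)
    path-ok : ∀ a b (e : T.Arc a b) → N.Chain (ψ a) (path a b e) (ψ b)
    path-disjoint : ∀ a b (e : T.Arc a b) a' b' (e' : T.Arc a' b') v →
                    v ∈ path a b e → v ∈ path a' b' e' → a ≡ a' × b ≡ b'
    path-avoid : ∀ a b (e : T.Arc a b) c → ψ c ∉ path a b e

Uses : ∀ {m n t} {T : Network m t} {N : Network m n} →
       Embedding T N → Fin n → Fin n → Set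
Uses {T = T} {N = N} E x y =
  ∃[ a ] ∃[ b ] Σ[ e ∈ Network.Arc T a b ]
    Network.OnChain N (ψ a) (path a b e) (ψ b) x y
  where open Embedding E

-- Caterpillar ladder ⟨ℓ₀,…,ℓₖ⟩: vertices ℓⱼ (0 ≤ j ≤ k), vⱼ, pⱼ, qⱼ
-- (1 ≤ j ≤ k).  Indices are natural numbers; `Valid k` singles out the
-- vertices of the ladder.

data LV : Set where
  lf vv pp qq : ℕ → LV

Valid : ℕ → LV → Set
Valid k (lf j) = j ≤ k
Valid k (vv j) = 1 ≤ j × j ≤ k
Valid k (pp j) = 1 ≤ j × j ≤ k
Valid k (qq j) = 1 ≤ j × j ≤ k

spineDown : ℕ → List LV
spineDown zero    = []
spineDown (suc i) = qq (suc i) ∷ pp (suc (suc i)) ∷ spineDown i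

-- the spine q_k, q_{k-1}, p_k, …, q₁, p₂, p₁  (q₁, p₁ if k = 1)
spine : ℕ → List LV
spine k = qq k ∷ spineDown (k ∸ 1) ++ [ pp 1 ]

data Consec {A : Set} : List A → A → A → Set where
  head : ∀ {x y xs} → Consec (x ∷ y ∷ xs) x y
  tail : ∀ {z xs x y} → Consec xs x y → Consec (z ∷ xs) x y

-- "p₂": when k = 1 this denotes q₁
pTwo : ℕ → LV
pTwo 1 = qq 1
pTwo _ = pp 2

record LooseLadder {m n : ℕ} (N : Network m n) (k : ℕ)
                   (lab : ℕ → Fin m) (φ : LV → Fin n) : Set where
  open Network N
  field
    k≥1        : 1 ≤ k
    lab-distinct : ∀ i j → i ≤ k → j ≤ k → lab i ≡ lab j → i ≡ j
    φ-inj      : ∀ x y → Valid k x → Valid k y → φ x ≡ φ y → x ≡ y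
    φ-leaf     : ∀ j → j ≤ k → φ (lf j) ≡ leaf (lab j)
    P1-root    : TreePath (φ (pp 1)) (leaf (lab 0))
    P1         : ∀ j → 1 ≤ j → j ≤ k → TreePath (φ (vv j)) (leaf (lab j))
    P2-p       : ∀ j → 1 ≤ j → j ≤ k → Arc (φ (pp j)) (φ (vv j))
    P2-q       : ∀ j → 1 ≤ j → j ≤ k → Arc (φ (qq j)) (φ (vv j))
    P3-tree    : ∀ u w → Consec (spine k) u w → (u , w) ≢ (pTwo k , pp 1) →
                 TreePath (φ u) (φ w)
    P3-last    : DPath (φ (pTwo k)) (φ (pp 1))

-- Fix j < k and suppose E uses e_{j+1} but not e_j.  Every leaf is reached
-- from the image of the root along arcs of E, so E enters v_j, necessarily
-- through f_j.  Let ℓ be a leaf below the tree child of φ(p_{j+1}).  In E the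
-- vertex φ(p_{j+1}) then branches towards ℓ_{j+1} and ℓ but cannot reach ℓ_j,
-- so T displays the triplet ℓ_{j+1}ℓ|ℓ_j.  In E′, which uses f_j and f_{j+1},
-- the vertex φ(q_j) branches towards ℓ_j and ℓ (along the tree path to
-- φ(p_{j+1})) but cannot reach ℓ_{j+1}, so T displays ℓ_jℓ|ℓ_{j+1}.  A tree
-- displays at most one triplet on three leaves.  Downward induction from e_k
-- gives the claim.

module Submission where

open import Defs
open import Axiom.UniquenessOfIdentityProofs using (module Decidable⇒UIP)
open import Data.Bool using (Bool; T?)
import Data.Bool as Bool
open import Data.Bool.Properties using (T-≡)
open import Data.Empty using (⊥-elim)
open import Data.Fin using (Fin; toℕ)
import Data.Fin as Fin
open import Data.Fin.Properties using (pigeonhole; toℕ≤pred[n])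
open import Data.List using (List; []; _∷_; _++_; [_]; length; filterᵇ; allFin)
open import Data.List.Membership.Propositional using (_∈_; _∉_)
open import Data.List.Membership.Propositional.Properties
  using (∈-allFin; ∈-filter⁺; ∈-filter⁻)
open import Data.List.Relation.Unary.Any using (here; there)
open import Data.Nat using (ℕ; zero; suc; _≤_; _<_; _∸_; _≤‴_; ≤‴-refl; ≤‴-step; z≤n; s≤s)
import Data.Nat as ℕ
open import Data.Nat.Properties using (≤-trans; <⇒≤; n<1+n; m≤n⇒m<n∨m≡n; m∸n≤m; ≤⇒≤‴; ≤‴⇒≤)
open import Data.Product using (Σ; ∃; ∃₂; _×_; _,_; proj₁; proj₂)
open import Data.Sum using (_⊎_; inj₁; inj₂)
open import Function using (_∘_; flip)
open import Function.Bundles using (Equivalence)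
open import Relation.Binary.Construct.Closure.ReflexiveTransitive
  using (Star; ε; _◅_; _◅◅_; reverse) renaming (map to mapStar)
open import Relation.Binary.PropositionalEquality using (_≡_; _≢_; refl; sym; trans; cong; subst)
open import Relation.Nullary using (¬_; yes; no)
open import Relation.Nullary.Decidable using (_×-dec_)

unsnoc : ∀ {A : Set} {R : A → A → Set} {x y} →
         Star R x y → x ≡ y ⊎ ∃ λ z → Star R x z × R z y
unsnoc ε = inj₁ refl
unsnoc (r ◅ p) with unsnoc p
... | inj₁ refl = inj₂ (_ , ε , r)
... | inj₂ (z , q , r′) = inj₂ (z , r ◅ q , r′)

downward-induction : ∀ {k} (P : ℕ → Set) → P k →
                     (∀ {j} → j < k → P (suc j) → P j) → ∀ {j} → j ≤ k → P j
downward-induction {k} P Pk step = go ∘ ≤⇒≤‴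
  where
    go : ∀ {j} → j ≤‴ k → P j
    go ≤‴-refl         = Pk
    go (≤‴-step j<‴k) = step (≤‴⇒≤ j<‴k) (go j<‴k)

module _ {A : Set} where

  ∉-length≡0 : ∀ {x} {xs : List A} → length xs ≡ 0 → x ∉ xs
  ∉-length≡0 {xs = []} _ ()

  ∃∈-length≡1 : ∀ {xs : List A} → length xs ≡ 1 → ∃ (_∈ xs)
  ∃∈-length≡1 {xs = x ∷ _} _ = x , here refl

  ∈-length≡1 : ∀ {x y} {xs : List A} → length xs ≡ 1 → x ∈ xs → y ∈ xs → x ≡ y
  ∈-length≡1 {xs = _ ∷ []} _ (here refl) (here refl) = refl

  ∈-pair : ∀ {x a b : A} → x ∈ a ∷ b ∷ [] → x ≡ a ⊎ x ≡ b
  ∈-pair (here x≡a)         = inj₁ x≡a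
  ∈-pair (there (here x≡b)) = inj₂ x≡b

  ∈-length≡2 : ∀ {x y z} {xs : List A} → length xs ≡ 2 →
               x ∈ xs → y ∈ xs → z ∈ xs → x ≢ y → z ≡ x ⊎ z ≡ y
  ∈-length≡2 {xs = _ ∷ _ ∷ []} _ x∈ y∈ z∈ x≢y with ∈-pair x∈ | ∈-pair y∈ | ∈-pair z∈
  ... | inj₁ refl | inj₁ refl | _         = ⊥-elim (x≢y refl)
  ... | inj₂ refl | inj₂ refl | _         = ⊥-elim (x≢y refl)
  ... | inj₁ refl | inj₂ refl | inj₁ refl = inj₁ refl
  ... | inj₁ refl | inj₂ refl | inj₂ refl = inj₂ refl
  ... | inj₂ refl | inj₁ refl | inj₁ refl = inj₂ refl
  ... | inj₂ refl | inj₁ refl | inj₂ refl = inj₁ refl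

module FiniteDescent {n : ℕ} (R : Fin n → Fin n → Set)
                     (no-cycle : ∀ {x y} → R x y → ¬ Star R y x) where

  Walk : ℕ → Fin n → Set
  Walk k v = Σ (ℕ → Fin n) λ f → f 0 ≡ v × (∀ {i} → i < k → R (f i) (f (suc i)))

  walk-segment : ∀ {k v} → ((f , _) : Walk k v) → ∀ {i j} → i ≤‴ j → j ≤ k → Star R (f i) (f j)
  walk-segment w ≤‴-refl         _   = ε
  walk-segment w (≤‴-step i<‴j) j≤k =
    proj₂ (proj₂ w) (≤-trans (≤‴⇒≤ i<‴j) j≤k) ◅ walk-segment w i<‴j j≤k

  ¬walk-of-length-n : ∀ {v} → ¬ Walk n v
  ¬walk-of-length-n w@(f , _ , steps) with pigeonhole (n<1+n n) (f ∘ toℕ)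
  ... | i , j , i<j , fi≡fj =
    no-cycle (steps (≤-trans i<j j≤n))
             (subst (Star R _) (sym fi≡fj) (walk-segment w (≤⇒≤‴ i<j) j≤n))
    where j≤n = toℕ≤pred[n] j

  module _ (P : Fin n → Set) (stop-or-step : ∀ v → P v ⊎ ∃ (R v)) where

    reach-or-walk : ∀ k v → (∃ λ w → Star R v w × P w) ⊎ Walk k v
    reach-or-walk zero v = inj₂ ((λ _ → v) , refl , λ ())
    reach-or-walk (suc k) v with stop-or-step v
    ... | inj₁ Pv = inj₁ (v , ε , Pv)
    ... | inj₂ (u , vu) with reach-or-walk k u
    ...   | inj₁ (w , u⇝w , Pw)      = inj₁ (w , vu ◅ u⇝w , Pw)
    ...   | inj₂ (f , f0≡u , steps) = inj₂ (g , refl , g-steps)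
      where
        g : ℕ → Fin n
        g zero    = v
        g (suc i) = f i
        g-steps : ∀ {i} → i < suc k → R (g i) (g (suc i))
        g-steps {zero}  _         = subst (R v) (sym f0≡u) vu
        g-steps {suc i} (s≤s i<k) = steps i<k

    descend : ∀ v → ∃ λ w → Star R v w × P w
    descend v with reach-or-walk n v
    ... | inj₁ found = found
    ... | inj₂ walk  = ⊥-elim (¬walk-of-length-n walk)

module DigraphDegree {n : ℕ} (arc : Fin n → Fin n → Bool) where
  open Digraph arc

  private
    parents children : Fin n → List (Fin n)
    parents v  = filterᵇ (λ w → arc w v) (allFin n)
    children u = filterᵇ (λ w → arc u w) (allFin n)

    ∈-parents : ∀ {u v} → Arc u v → u ∈ parents v
    ∈-parents {u} {v} uv =
      ∈-filter⁺ (T? ∘ λ w → arc w v) (∈-allFin u) (Equivalence.from T-≡ uv)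

    ∈-children : ∀ {u v} → Arc u v → v ∈ children u
    ∈-children {u} {v} uv =
      ∈-filter⁺ (T? ∘ λ w → arc u w) (∈-allFin v) (Equivalence.from T-≡ uv)

  indeg≡0⇒¬Arc : ∀ {u v} → indeg v ≡ 0 → ¬ Arc u v
  indeg≡0⇒¬Arc d = ∉-length≡0 d ∘ ∈-parents

  outdeg≡0⇒¬Arc : ∀ {u v} → outdeg u ≡ 0 → ¬ Arc u v
  outdeg≡0⇒¬Arc d = ∉-length≡0 d ∘ ∈-children

  indeg≡1⇒parent : ∀ {v} → indeg v ≡ 1 → ∃ λ u → Arc u v
  indeg≡1⇒parent {v} d with ∃∈-length≡1 {xs = parents v} d
  ... | u , u∈ =
    u , Equivalence.to T-≡ (proj₂ (∈-filter⁻ (T? ∘ λ w → arc w v) {xs = allFin n} u∈))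

  indeg≡1⇒parent-unique : ∀ {a b v} → indeg v ≡ 1 → Arc a v → Arc b v → a ≡ b
  indeg≡1⇒parent-unique d av bv = ∈-length≡1 d (∈-parents av) (∈-parents bv)

  indeg≡2⇒parent-of-two : ∀ {a b c v} → indeg v ≡ 2 →
                          Arc a v → Arc b v → a ≢ b → Arc c v → c ≡ a ⊎ c ≡ b
  indeg≡2⇒parent-of-two d av bv a≢b cv =
    ∈-length≡2 d (∈-parents av) (∈-parents bv) (∈-parents cv) a≢b

module NetworkProperties {m n : ℕ} (N : Network m n) where
  open Network N
  open DigraphDegree arc

  TreeOrLeaf : Fin n → Set
  TreeOrLeaf v = IsTreeVertex v ⊎ IsLeaf v

  arc-irrelevant : ∀ {u v} (e e′ : Arc u v) → e ≡ e′
  arc-irrelevant = Decidable⇒UIP.≡-irrelevant Bool._≟_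

  parent-unique : ∀ {a b v} → TreeOrLeaf v → Arc a v → Arc b v → a ≡ b
  parent-unique (inj₁ tv) = indeg≡1⇒parent-unique (proj₁ tv)
  parent-unique (inj₂ lv) = indeg≡1⇒parent-unique (proj₁ lv)

  two-parents⇒¬TreeOrLeaf : ∀ {a b v} → Arc a v → Arc b v → a ≢ b → ¬ TreeOrLeaf v
  two-parents⇒¬TreeOrLeaf av bv a≢b tl = a≢b (parent-unique tl av bv)

  ¬TreeOrLeaf⇒≢ : ∀ {v w} → ¬ TreeOrLeaf v → TreeOrLeaf w → v ≢ w
  ¬TreeOrLeaf⇒≢ ¬tv tw refl = ¬tv tw

  arc-head≢root : ∀ {u v} → Arc u v → v ≢ root
  arc-head≢root uv refl = indeg≡0⇒¬Arc (proj₁ root-deg) uv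

  leaf-childless : ∀ ℓ {w} → ¬ Arc (leaf ℓ) w
  leaf-childless ℓ = outdeg≡0⇒¬Arc (leaf-out ℓ)

  arc-tail-¬leaf : ∀ {u v} → Arc u v → ¬ IsLeaf u
  arc-tail-¬leaf uv lv = outdeg≡0⇒¬Arc (proj₂ lv) uv

  parent-of-two : ∀ {a b c v} → Arc a v → Arc b v → a ≢ b → Arc c v → c ≡ a ⊎ c ≡ b
  parent-of-two av bv a≢b cv with vertex-kinds _ (arc-head≢root av)
  ... | inj₁ lv        = ⊥-elim (two-parents⇒¬TreeOrLeaf av bv a≢b (inj₂ lv))
  ... | inj₂ (inj₁ tv) = ⊥-elim (two-parents⇒¬TreeOrLeaf av bv a≢b (inj₁ tv))
  ... | inj₂ (inj₂ rv) = indeg≡2⇒parent-of-two (proj₁ rv) av bv a≢b cv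

  no-cycle : ∀ {a b} → Arc a b → ¬ Star Arc b a
  no-cycle ab b⇝a = acyclic _ (reach⁺ ab b⇝a)
    where
      reach⁺ : ∀ {a b c} → Arc a b → Star Arc b c → Reach⁺ a c
      reach⁺ ab ε          = one ab
      reach⁺ ab (bc ◅ c⇝d) = more ab (reach⁺ bc c⇝d)

  star-antisym : ∀ {a b} → Star Arc a b → Star Arc b a → a ≡ b
  star-antisym ε          _    = refl
  star-antisym (ab ◅ b⇝c) c⇝a = ⊥-elim (no-cycle ab (b⇝c ◅◅ c⇝a))

  treePath⇒star : ∀ {u w} → TreePath u w → Star Arc u w
  treePath⇒star here            = ε
  treePath⇒star (step ux _ x⇝w) = ux ◅ treePath⇒star x⇝w

  _++ᵗ_ : ∀ {u v w} → TreePath u v → TreePath v w → TreePath u w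
  here            ++ᵗ v⇝w = v⇝w
  step ux tx x⇝v ++ᵗ v⇝w = step ux tx (x⇝v ++ᵗ v⇝w)
  infixr 5 _++ᵗ_

  treePath-first-step : ∀ {u w} → TreePath u w → u ≢ w →
                        ∃ λ d → Arc u d × TreeOrLeaf d × TreePath d w
  treePath-first-step here             u≢u = ⊥-elim (u≢u refl)
  treePath-first-step (step ud td d⇝w) _   = _ , ud , td , d⇝w

  -- Every vertex after the first of a tree path has a unique parent, so a
  -- path into its end either passes through its start or starts inside it.
  enter-treePath : ∀ {R : Fin n → Fin n → Set} → (∀ {a b} → R a b → Arc a b) →
                   ∀ {u w x} → TreePath u w → Star R x w →
                   (Star R x u × Star R u w) ⊎
                   ((∃ λ y → Arc u y × Star Arc y x) × TreeOrLeaf x)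
  enter-treePath R⇒Arc here x⇝w = inj₁ (x⇝w , ε)
  enter-treePath R⇒Arc (step uy ty y⇝w) x⇝w with enter-treePath R⇒Arc y⇝w x⇝w
  ... | inj₂ ((_ , yz , z⇝x) , tx) = inj₂ ((_ , uy , yz ◅ z⇝x) , tx)
  ... | inj₁ (x⇝y , y⇝w) with unsnoc x⇝y
  ...   | inj₁ refl = inj₂ ((_ , uy , ε) , ty)
  ...   | inj₂ (z , x⇝z , zy) with parent-unique ty (R⇒Arc zy) uy
  ...     | refl = inj₁ (x⇝z , zy ◅ y⇝w)

  ¬side-child⇝treePath : ∀ {x y v} → TreePath x y → Arc x v → ¬ TreeOrLeaf v → ¬ Star Arc v y
  ¬side-child⇝treePath x⇝y xv ¬tv v⇝y with enter-treePath (λ a → a) x⇝y v⇝y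
  ... | inj₁ (v⇝x , _) = no-cycle xv v⇝x
  ... | inj₂ (_ , tv)  = ¬tv tv

  private
    TreeArc : Fin n → Fin n → Set
    TreeArc u w = Arc u w × TreeOrLeaf w

    treeArcs⇒treePath : ∀ {u w} → Star TreeArc u w → TreePath u w
    treeArcs⇒treePath ε                 = here
    treeArcs⇒treePath ((ux , tx) ◅ x⇝w) = step ux tx (treeArcs⇒treePath x⇝w)

  treePath-to-leaf : TreeChild N → ∀ v → ∃ λ ℓ → TreePath v (leaf ℓ)
  treePath-to-leaf tc v with FiniteDescent.descend TreeArc no-tree-cycle IsLeaf leaf-or-step v
    where
      no-tree-cycle : ∀ {u w} → TreeArc u w → ¬ Star TreeArc w u
      no-tree-cycle (uw , _) w⇝u = no-cycle uw (mapStar proj₁ w⇝u)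

      leaf-or-step : ∀ u → IsLeaf u ⊎ ∃ (TreeArc u)
      leaf-or-step u with (indeg u ℕ.≟ 1) ×-dec (outdeg u ℕ.≟ 0)
      ... | yes lv = inj₁ lv
      ... | no ¬lv = inj₂ (tc u ¬lv)
  ... | z , v⇝z , lv with leaves-X z (proj₂ lv)
  ...   | ℓ , refl = ℓ , treeArcs⇒treePath v⇝z

  onChain⇒arc : ∀ {u xs w x y} → Chain u xs w → OnChain u xs w x y → Arc x y
  onChain⇒arc {xs = []}    uw             (refl , refl)        = uw
  onChain⇒arc {xs = _ ∷ _} (uz , _)       (inj₁ (refl , refl)) = uz
  onChain⇒arc {xs = _ ∷ _} (_ , z-chain) (inj₂ on)            = onChain⇒arc z-chain on

  onChain-source : ∀ {u xs w x y} → OnChain u xs w x y → x ≡ u ⊎ x ∈ xs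
  onChain-source {xs = []}    (x≡u , _)        = inj₁ x≡u
  onChain-source {xs = _ ∷ _} (inj₁ (x≡u , _)) = inj₁ x≡u
  onChain-source {xs = _ ∷ _} (inj₂ on) with onChain-source on
  ... | inj₁ x≡z = inj₂ (here x≡z)
  ... | inj₂ x∈  = inj₂ (there x∈)

  onChain-target : ∀ {u xs w x y} → OnChain u xs w x y → y ∈ xs ⊎ y ≡ w
  onChain-target {xs = []}    (_ , y≡w)        = inj₂ y≡w
  onChain-target {xs = _ ∷ _} (inj₁ (_ , y≡z)) = inj₁ (here y≡z)
  onChain-target {xs = _ ∷ _} (inj₂ on) with onChain-target on
  ... | inj₁ y∈  = inj₁ (there y∈)
  ... | inj₂ y≡w = inj₂ y≡w

  chain⇒star : ∀ {u xs w} → Chain u xs w → Star (OnChain u xs w) u w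
  chain⇒star {xs = []}    _             = (refl , refl) ◅ ε
  chain⇒star {xs = _ ∷ _} (_ , z-chain) =
    inj₁ (refl , refl) ◅ mapStar inj₂ (chain⇒star z-chain)

  chain-prefix : ∀ {u xs w x y} → Chain u xs w → OnChain u xs w x y → Star (OnChain u xs w) u x
  chain-prefix {xs = []}    _             (refl , refl)        = ε
  chain-prefix {xs = _ ∷ _} _             (inj₁ (refl , refl)) = ε
  chain-prefix {xs = _ ∷ _} (_ , z-chain) (inj₂ on) =
    inj₁ (refl , refl) ◅ mapStar inj₂ (chain-prefix z-chain on)

  interior-successor : ∀ {u xs w y} → Chain u xs w → y ∈ xs → ∃ (OnChain u xs w y)
  interior-successor {xs = _ ∷ []}    _             (here refl) = _ , inj₂ (refl , refl)
  interior-successor {xs = _ ∷ _ ∷ _} _             (here refl) = _ , inj₂ (inj₁ (refl , refl))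
  interior-successor {xs = _ ∷ _}     (_ , z-chain) (there y∈) with interior-successor z-chain y∈
  ... | z , on = z , inj₂ on

  private
    chain-prefix-arcs : ∀ {u xs w x y} → Chain u xs w → OnChain u xs w x y → Star Arc u x
    chain-prefix-arcs chain on = mapStar (onChain⇒arc chain) (chain-prefix chain on)

  onChain-pred-unique : ∀ {u xs w x x′ y} → Chain u xs w →
                        OnChain u xs w x y → OnChain u xs w x′ y → x ≡ x′
  onChain-pred-unique {xs = []}    _ (x≡u , _) (x′≡u , _) = trans x≡u (sym x′≡u)
  onChain-pred-unique {xs = _ ∷ _} _ (inj₁ (x≡u , _)) (inj₁ (x′≡u , _)) = trans x≡u (sym x′≡u)
  onChain-pred-unique {xs = _ ∷ _} (_ , z-chain) (inj₁ (_ , refl)) (inj₂ on′) =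
    ⊥-elim (no-cycle (onChain⇒arc z-chain on′) (chain-prefix-arcs z-chain on′))
  onChain-pred-unique {xs = _ ∷ _} (_ , z-chain) (inj₂ on) (inj₁ (_ , refl)) =
    ⊥-elim (no-cycle (onChain⇒arc z-chain on) (chain-prefix-arcs z-chain on))
  onChain-pred-unique {xs = _ ∷ _} (_ , z-chain) (inj₂ on) (inj₂ on′) =
    onChain-pred-unique z-chain on on′

  onChain-succ-unique : ∀ {u xs w x y y′} → Chain u xs w →
                        OnChain u xs w x y → OnChain u xs w x y′ → y ≡ y′
  onChain-succ-unique {xs = []}    _ (_ , y≡w) (_ , y′≡w) = trans y≡w (sym y′≡w)
  onChain-succ-unique {xs = _ ∷ _} _ (inj₁ (_ , y≡z)) (inj₁ (_ , y′≡z)) = trans y≡z (sym y′≡z)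
  onChain-succ-unique {xs = _ ∷ _} (uz , z-chain) (inj₁ (refl , refl)) (inj₂ on′) =
    ⊥-elim (no-cycle uz (chain-prefix-arcs z-chain on′))
  onChain-succ-unique {xs = _ ∷ _} (uz , z-chain) (inj₂ on) (inj₁ (refl , refl)) =
    ⊥-elim (no-cycle uz (chain-prefix-arcs z-chain on))
  onChain-succ-unique {xs = _ ∷ _} (_ , z-chain) (inj₂ on) (inj₂ on′) =
    onChain-succ-unique z-chain on on′

module TreeProperties {m t : ℕ} (T : Network m t) (isT : IsPhyloTree T) where
  open Network T
  open DigraphDegree arc
  open NetworkProperties T using (no-cycle)

  private
    indeg≡1 : ∀ {v} → v ≢ root → indeg v ≡ 1
    indeg≡1 {v} v≢root with vertex-kinds v v≢root
    ... | inj₁ lv        = proj₁ lv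
    ... | inj₂ (inj₁ tv) = proj₁ tv
    ... | inj₂ (inj₂ rv) = ⊥-elim (isT v rv)

  tree-parent-unique : ∀ {a a′ b} → Arc a b → Arc a′ b → a ≡ a′
  tree-parent-unique ab a′b =
    indeg≡1⇒parent-unique (indeg≡1 (NetworkProperties.arc-head≢root T ab)) ab a′b

  root-reaches : ∀ v → Star Arc root v
  root-reaches v with FiniteDescent.descend (flip Arc) no-back-cycle (_≡ root) root-or-parent v
    where
      no-back-cycle : ∀ {x y} → Arc y x → ¬ Star (flip Arc) y x
      no-back-cycle yx y⇜x = no-cycle yx (reverse (λ a → a) y⇜x)

      root-or-parent : ∀ v → v ≡ root ⊎ ∃ λ u → Arc u v
      root-or-parent v with v Fin.≟ root
      ... | yes v≡root = inj₁ v≡root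
      ... | no  v≢root = inj₂ (indeg≡1⇒parent (indeg≡1 v≢root))
  ... | _ , root⇜v , refl = reverse (λ a → a) root⇜v

  ancestors-comparable : ∀ {A B x} → Star Arc A x → Star Arc B x → Star Arc A B ⊎ Star Arc B A
  ancestors-comparable ε          B⇝x = inj₂ B⇝x
  ancestors-comparable (AC ◅ C⇝x) B⇝x with ancestors-comparable C⇝x B⇝x
  ... | inj₁ C⇝B = inj₁ (AC ◅ C⇝B)
  ... | inj₂ B⇝C with unsnoc B⇝C
  ...   | inj₁ refl = inj₁ (AC ◅ ε)
  ...   | inj₂ (D , B⇝D , DC) with tree-parent-unique DC AC
  ...     | refl = inj₂ B⇝D

  DisplaysTriplet : Fin m → Fin m → Fin m → Set
  DisplaysTriplet x y z =
    ∃ λ A → Star Arc A (leaf x) × Star Arc A (leaf y) × ¬ Star Arc A (leaf z)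

  triplet-exclusive : ∀ {x y z} → DisplaysTriplet x y z → ¬ DisplaysTriplet z y x
  triplet-exclusive (A , A⇝x , A⇝y , ¬A⇝z) (B , B⇝z , B⇝y , ¬B⇝x)
    with ancestors-comparable A⇝y B⇝y
  ... | inj₁ A⇝B = ¬A⇝z (A⇝B ◅◅ B⇝z)
  ... | inj₂ B⇝A = ¬B⇝x (B⇝A ◅◅ A⇝x)

module EmbeddingProperties {m n t : ℕ} {N : Network m n} {T : Network m t}
                           (isT : IsPhyloTree T) (E : Embedding T N) where
  private
    module N = Network N
    module T = Network T
  open Embedding E
  open NetworkProperties N
  open TreeProperties T isT

  private
    T-arc-irrelevant : ∀ {a b} (e e′ : T.Arc a b) → e ≡ e′
    T-arc-irrelevant = NetworkProperties.arc-irrelevant T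

  Used : Fin n → Fin n → Set
  Used = Uses E

  used⇒arc : ∀ {x y} → Used x y → N.Arc x y
  used⇒arc (a , b , e , on) = onChain⇒arc (path-ok a b e) on

  usedPath⇒path : ∀ {x y} → Star Used x y → Star N.Arc x y
  usedPath⇒path = mapStar used⇒arc

  lift : ∀ {A B} → Star T.Arc A B → Star Used (ψ A) (ψ B)
  lift ε                   = ε
  lift (_◅_ {A} {B} e B⇝C) =
    mapStar (λ on → A , B , e , on) (chain⇒star (path-ok A B e)) ◅◅ lift B⇝C

  lift-to-leaf : ∀ {A ℓ} → Star T.Arc A (T.leaf ℓ) → Star Used (ψ A) (N.leaf ℓ)
  lift-to-leaf {ℓ = ℓ} = subst (Star Used _) (ψ-leaf ℓ) ∘ lift

  top : Fin n
  top = ψ T.root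

  top-reaches-leaf : ∀ ℓ → Star Used top (N.leaf ℓ)
  top-reaches-leaf ℓ = lift-to-leaf (root-reaches (T.leaf ℓ))

  used⇒reached : ∀ {x y} → Used x y → Star Used top x
  used⇒reached (a , b , e , on) =
    lift (root-reaches a) ◅◅
    mapStar (λ on′ → a , b , e , on′) (chain-prefix (path-ok a b e) on)

  used-pred-unique : ∀ {x x′ y} → Used x y → Used x′ y → x ≡ x′
  used-pred-unique (a , b , e , on) (a′ , b′ , e′ , on′)
    with onChain-target on | onChain-target on′
  ... | inj₁ y∈ | inj₁ y∈′ with path-disjoint a b e a′ b′ e′ _ y∈ y∈′
  ...   | refl , refl with T-arc-irrelevant e e′
  ...     | refl = onChain-pred-unique (path-ok a b e) on on′
  used-pred-unique (a , b , e , on) (a′ , b′ , e′ , on′) | inj₁ y∈ | inj₂ y≡ψb′ =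
    ⊥-elim (path-avoid a b e b′ (subst (_∈ _) y≡ψb′ y∈))
  used-pred-unique (a , b , e , on) (a′ , b′ , e′ , on′) | inj₂ y≡ψb | inj₁ y∈′ =
    ⊥-elim (path-avoid a′ b′ e′ b (subst (_∈ _) y≡ψb y∈′))
  used-pred-unique (a , b , e , on) (a′ , b′ , e′ , on′) | inj₂ y≡ψb | inj₂ y≡ψb′
    with ψ-inj (trans (sym y≡ψb) y≡ψb′)
  ... | refl with tree-parent-unique e e′
  ...   | refl with T-arc-irrelevant e e′
  ...     | refl = onChain-pred-unique (path-ok a b e) on on′

  used-branch⇒image : ∀ {x y y′} → Used x y → Used x y′ → y ≢ y′ → ∃ λ A → ψ A ≡ x
  used-branch⇒image (a , b , e , on) (a′ , b′ , e′ , on′) y≢y′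
    with onChain-source on | onChain-source on′
  ... | inj₁ x≡ψa | _         = a , sym x≡ψa
  ... | inj₂ _    | inj₁ x≡ψa′ = a′ , sym x≡ψa′
  ... | inj₂ x∈   | inj₂ x∈′ with path-disjoint a b e a′ b′ e′ _ x∈ x∈′
  ...   | refl , refl with T-arc-irrelevant e e′
  ...     | refl = ⊥-elim (y≢y′ (onChain-succ-unique (path-ok a b e) on on′))

  -- y lies on the image of the subdivided tree at c or strictly inside the
  -- image of the arc into c; a path of used arcs then follows T below c.
  Anchored : Fin n → Fin t → Set
  Anchored y c = ψ c ≡ y ⊎ ∃₂ λ a (e : T.Arc a c) → y ∈ path a c e

  private
    target-anchored : ∀ {a b y y′} {e : T.Arc a b} →
                      N.OnChain (ψ a) (path a b e) (ψ b) y y′ → Anchored y′ b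
    target-anchored {a} {e = e} on with onChain-target on
    ... | inj₁ y′∈   = inj₂ (a , e , y′∈)
    ... | inj₂ y′≡ψb = inj₁ (sym y′≡ψb)

  anchored-step : ∀ {y y′ c} → Used y y′ → Anchored y c →
                  Anchored y′ c ⊎ ∃ λ c′ → T.Arc c c′ × Anchored y′ c′
  anchored-step {c = c} (a′ , b′ , e′ , on) anc with onChain-source on | anc
  ... | inj₁ y≡ψa′ | inj₁ ψc≡y with ψ-inj (trans ψc≡y y≡ψa′)
  ...   | refl = inj₂ (b′ , e′ , target-anchored on)
  anchored-step {c = c} (a′ , b′ , e′ , on) anc | inj₁ y≡ψa′ | inj₂ (a , e , y∈) =
    ⊥-elim (path-avoid a c e a′ (subst (_∈ _) y≡ψa′ y∈))
  anchored-step {c = c} (a′ , b′ , e′ , on) anc | inj₂ y∈′ | inj₁ ψc≡y =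
    ⊥-elim (path-avoid a′ b′ e′ c (subst (_∈ _) (sym ψc≡y) y∈′))
  anchored-step {c = c} (a′ , b′ , e′ , on) anc | inj₂ y∈′ | inj₂ (a , e , y∈)
    with path-disjoint a c e a′ b′ e′ _ y∈ y∈′
  ... | refl , refl = inj₁ (target-anchored on)

  lower-from : ∀ {y c ℓ} → Star Used y (N.leaf ℓ) → Anchored y c → Star T.Arc c (T.leaf ℓ)
  lower-from {c = c} {ℓ} ε (inj₁ ψc≡ℓ) with ψ-inj (trans ψc≡ℓ (sym (ψ-leaf ℓ)))
  ... | refl = ε
  lower-from {ℓ = ℓ} ε (inj₂ (a , e , ℓ∈)) =
    ⊥-elim (leaf-childless ℓ (onChain⇒arc chain (proj₂ (interior-successor chain ℓ∈))))
    where chain = path-ok a _ e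
  lower-from (yy′ ◅ y′⇝ℓ) anc with anchored-step yy′ anc
  ... | inj₁ anc′            = lower-from y′⇝ℓ anc′
  ... | inj₂ (_ , cc′ , anc′) = cc′ ◅ lower-from y′⇝ℓ anc′

  lower : ∀ {A ℓ} → Star Used (ψ A) (N.leaf ℓ) → Star T.Arc A (T.leaf ℓ)
  lower A⇝ℓ = lower-from A⇝ℓ (inj₁ refl)

  follows-treePath : ∀ {u v ℓ} → Used u v → N.TreePath v (N.leaf ℓ) → Star Used v (N.leaf ℓ)
  follows-treePath uv v⇝ℓ with enter-treePath used⇒arc v⇝ℓ (top-reaches-leaf _)
  ... | inj₁ (_ , v⇝ℓ′)            = v⇝ℓ′
  ... | inj₂ ((_ , vy , y⇝top) , _) =
    ⊥-elim (no-cycle vy (y⇝top ◅◅ usedPath⇒path (used⇒reached uv ◅◅ uv ◅ ε)))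

  uses-tree-arc : ∀ {u c ℓ} → Star Used top u → N.Arc u c → TreeOrLeaf c →
                  N.TreePath c (N.leaf ℓ) → Used u c
  uses-tree-arc top⇝u uc tl c⇝ℓ with enter-treePath used⇒arc c⇝ℓ (top-reaches-leaf _)
  ... | inj₂ ((_ , cy , y⇝top) , _) =
    ⊥-elim (no-cycle cy (y⇝top ◅◅ usedPath⇒path top⇝u ◅◅ uc ◅ ε))
  ... | inj₁ (top⇝c , _) with unsnoc top⇝c
  ...   | inj₁ refl = ⊥-elim (no-cycle uc (usedPath⇒path top⇝u))
  ...   | inj₂ (x , _ , xc) with parent-unique tl (used⇒arc xc) uc
  ...     | refl = xc

  used-arc-into : ∀ {v ℓ} → ¬ Star N.Arc v top → N.TreePath v (N.leaf ℓ) → ∃ λ x → Used x v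
  used-arc-into v⇏top v⇝ℓ with enter-treePath used⇒arc v⇝ℓ (top-reaches-leaf _)
  ... | inj₂ ((_ , vy , y⇝top) , _) = ⊥-elim (v⇏top (vy ◅ y⇝top))
  ... | inj₁ (top⇝v , _) with unsnoc top⇝v
  ...   | inj₁ refl         = ⊥-elim (v⇏top ε)
  ...   | inj₂ (x , _ , xv) = x , xv

  -- A used path from y to the leaf would enter v either from its E-parent x,
  -- putting y above x, or from the tree path below v, so that v reaches y.
  ¬reaches-below-sibling : ∀ {x y v ℓ} → Used x v → ¬ TreeOrLeaf v →
                           N.TreePath x y → y ≢ x → y ≢ v →
                           N.TreePath v (N.leaf ℓ) → ¬ Star Used y (N.leaf ℓ)
  ¬reaches-below-sibling xv ¬tv x⇝y y≢x y≢v v⇝ℓ y⇝ℓ with enter-treePath used⇒arc v⇝ℓ y⇝ℓ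
  ... | inj₂ ((_ , vz , z⇝y) , _) = ¬side-child⇝treePath x⇝y (used⇒arc xv) ¬tv (vz ◅ z⇝y)
  ... | inj₁ (y⇝v , _) with unsnoc y⇝v
  ...   | inj₁ y≡v = y≢v y≡v
  ...   | inj₂ (z , y⇝z , zv) with used-pred-unique zv xv
  ...     | refl = y≢x (star-antisym (usedPath⇒path y⇝z) (treePath⇒star x⇝y))

  branch⇒displays : ∀ {x y y′ ℓ ℓ′ ℓ″} → Used x y → Used x y′ → y ≢ y′ →
                    Star Used y (N.leaf ℓ) → Star Used y′ (N.leaf ℓ′) →
                    ¬ Star Used x (N.leaf ℓ″) → DisplaysTriplet ℓ ℓ′ ℓ″
  branch⇒displays xy xy′ y≢y′ y⇝ℓ y′⇝ℓ′ ¬x⇝ℓ″ with used-branch⇒image xy xy′ y≢y′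
  ... | A , refl = A , lower (xy ◅ y⇝ℓ) , lower (xy′ ◅ y′⇝ℓ′) , ¬x⇝ℓ″ ∘ lift-to-leaf

-- The part of a caterpillar ladder between two consecutive rungs: index 0
-- stands for the rung j and index 1 for the rung j + 1.
record Rung {m n : ℕ} (N : Network m n) : Set where
  open Network N
  field
    p₀ q₀ v₀ p₁ q₁ v₁ : Fin n
    ℓ₀ ℓ₁ : Fin m
    p₀v₀ : Arc p₀ v₀
    q₀v₀ : Arc q₀ v₀
    p₁v₁ : Arc p₁ v₁
    q₁v₁ : Arc q₁ v₁
    q₁⇝q₀ : TreePath q₁ q₀
    q₀⇝p₁ : TreePath q₀ p₁
    v₀⇝ℓ₀ : TreePath v₀ (leaf ℓ₀)
    v₁⇝ℓ₁ : TreePath v₁ (leaf ℓ₁)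
    p₀≢q₀ : p₀ ≢ q₀
    p₁≢q₁ : p₁ ≢ q₁
    p₁≢q₀ : p₁ ≢ q₀
    p₁≢v₀ : p₁ ≢ v₀
    q₀≢q₁ : q₀ ≢ q₁
    q₀≢v₁ : q₀ ≢ v₁

module _ {m n t : ℕ} {N : Network m n} (tc : TreeChild N)
         {T : Network m t} (isT : IsPhyloTree T) (R : Rung N) where
  open Network N using (Arc; TreePath; step)
  open NetworkProperties N
  open TreeProperties T isT using (DisplaysTriplet; triplet-exclusive)
  open Rung R

  private
    ¬tv₀ : ¬ TreeOrLeaf v₀
    ¬tv₀ = two-parents⇒¬TreeOrLeaf p₀v₀ q₀v₀ p₀≢q₀

    ¬tv₁ : ¬ TreeOrLeaf v₁
    ¬tv₁ = two-parents⇒¬TreeOrLeaf p₁v₁ q₁v₁ p₁≢q₁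

    p₁-tree-child : ∃ λ c → Arc p₁ c × TreeOrLeaf c
    p₁-tree-child = tc p₁ (arc-tail-¬leaf p₁v₁)

    c = proj₁ p₁-tree-child
    p₁c = proj₁ (proj₂ p₁-tree-child)
    tl-c = proj₂ (proj₂ p₁-tree-child)

  ℓ : Fin m
  ℓ = proj₁ (treePath-to-leaf tc c)

  private
    c⇝ℓ : TreePath c (Network.leaf N ℓ)
    c⇝ℓ = proj₂ (treePath-to-leaf tc c)

  displays-via-e₁ : (E : Embedding T N) → Uses E p₁ v₁ → Uses E q₀ v₀ → DisplaysTriplet ℓ₁ ℓ ℓ₀
  displays-via-e₁ E Ep₁v₁ Eq₀v₀ =
    branch⇒displays Ep₁v₁ Ep₁c (¬TreeOrLeaf⇒≢ ¬tv₁ tl-c)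
      (follows-treePath Ep₁v₁ v₁⇝ℓ₁) (follows-treePath Ep₁c c⇝ℓ)
      (¬reaches-below-sibling Eq₀v₀ ¬tv₀ q₀⇝p₁ p₁≢q₀ p₁≢v₀ v₀⇝ℓ₀)
    where
      open EmbeddingProperties isT E
      Ep₁c = uses-tree-arc (used⇒reached Ep₁v₁) p₁c tl-c c⇝ℓ

  displays-via-f₁ : (E : Embedding T N) → Uses E q₀ v₀ → Uses E q₁ v₁ → DisplaysTriplet ℓ₀ ℓ ℓ₁
  displays-via-f₁ E Eq₀v₀ Eq₁v₁ with treePath-first-step q₀⇝p₁ (p₁≢q₀ ∘ sym)
  ... | d , q₀d , td , d⇝p₁ =
    branch⇒displays Eq₀v₀ Eq₀d (¬TreeOrLeaf⇒≢ ¬tv₀ td)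
      (follows-treePath Eq₀v₀ v₀⇝ℓ₀) (follows-treePath Eq₀d d⇝ℓ)
      (¬reaches-below-sibling Eq₁v₁ ¬tv₁ q₁⇝q₀ q₀≢q₁ q₀≢v₁ v₁⇝ℓ₁)
    where
      open EmbeddingProperties isT E
      d⇝ℓ = d⇝p₁ ++ᵗ step p₁c tl-c c⇝ℓ
      Eq₀d = uses-tree-arc (used⇒reached Eq₀v₀) q₀d td d⇝ℓ

  rung-step : (E E′ : Embedding T N) →
              Uses E′ q₀ v₀ → Uses E′ q₁ v₁ → Uses E p₁ v₁ → Uses E p₀ v₀
  rung-step E E′ E′q₀v₀ E′q₁v₁ Ep₁v₁ = entered-from-p₀ (used-arc-into v₀⇏top v₀⇝ℓ₀)
    where
      open EmbeddingProperties isT E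

      v₀⇏top : ¬ Star Arc v₀ top
      v₀⇏top v₀⇝top =
        ¬side-child⇝treePath q₀⇝p₁ q₀v₀ ¬tv₀ (v₀⇝top ◅◅ usedPath⇒path (used⇒reached Ep₁v₁))

      entered-from-p₀ : (∃ λ x → Used x v₀) → Used p₀ v₀
      entered-from-p₀ (x , xv₀) with parent-of-two p₀v₀ q₀v₀ p₀≢q₀ (used⇒arc xv₀)
      ... | inj₁ refl = xv₀
      ... | inj₂ refl = ⊥-elim (triplet-exclusive (displays-via-e₁ E Ep₁v₁ xv₀)
                                                  (displays-via-f₁ E′ E′q₀v₀ E′q₁v₁))

spineDown-q→p : ∀ {i j} rest → 1 ≤ j → j ≤ i →
                Consec (spineDown i ++ rest) (qq j) (pp (suc j))
spineDown-q→p {zero}  _    (s≤s _) ()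
spineDown-q→p {suc i} rest 1≤j j≤1+i with m≤n⇒m<n∨m≡n j≤1+i
... | inj₂ refl      = head
... | inj₁ (s≤s j≤i) = tail (tail (spineDown-q→p rest 1≤j j≤i))

spineDown-p→q : ∀ {i j} rest → 1 ≤ j → suc j ≤ i →
                Consec (spineDown i ++ rest) (pp (suc (suc j))) (qq j)
spineDown-p→q {suc i} rest 1≤j@(s≤s z≤n) (s≤s j≤i) with m≤n⇒m<n∨m≡n j≤i
... | inj₂ refl = tail head
... | inj₁ j<i  = tail (tail (spineDown-p→q {i} rest 1≤j j<i))

spine-q→p : ∀ {k j} → 1 ≤ j → j < k → Consec (spine k) (qq j) (pp (suc j))
spine-q→p 1≤j (s≤s j≤i) = tail (spineDown-q→p [ pp 1 ] 1≤j j≤i)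

spine-p→q : ∀ {k j} → 1 ≤ j → suc j < k → Consec (spine k) (pp (suc (suc j))) (qq j)
spine-p→q 1≤j (s≤s 1+j≤i) = tail (spineDown-p→q [ pp 1 ] 1≤j 1+j≤i)

spine-q→q : ∀ {k j} → 1 ≤ j → suc j ≡ k → Consec (spine k) (qq (suc j)) (qq j)
spine-q→q (s≤s z≤n) refl = head

module _ {m n k : ℕ} {N : Network m n} {lab : ℕ → Fin m} {φ : LV → Fin n}
         (L : LooseLadder N k lab φ) where
  open Network N using (TreePath)
  open NetworkProperties N using (_++ᵗ_)
  open LooseLadder L

  private
    spine-treePath : ∀ {u w} → Consec (spine k) u w → w ≢ pp 1 → TreePath (φ u) (φ w)
    spine-treePath {u} {w} uw w≢p₁ = P3-tree u w uw (w≢p₁ ∘ cong proj₂)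

    pp-suc≢pp-1 : ∀ {j} → 1 ≤ j → pp (suc j) ≢ pp 1
    pp-suc≢pp-1 (s≤s z≤n) ()

    q-treePath : ∀ {j} → 1 ≤ j → j < k → TreePath (φ (qq (suc j))) (φ (qq j))
    q-treePath 1≤j j<k with m≤n⇒m<n∨m≡n j<k
    ... | inj₂ 1+j≡k = spine-treePath (spine-q→q 1≤j 1+j≡k) (λ ())
    ... | inj₁ 1+j<k = spine-treePath (spine-q→p (s≤s z≤n) 1+j<k) (pp-suc≢pp-1 (s≤s z≤n))
                       ++ᵗ spine-treePath (spine-p→q 1≤j 1+j<k) (λ ())

    φ-distinct : ∀ {x y} → Valid k x → Valid k y → x ≢ y → φ x ≢ φ y
    φ-distinct vx vy x≢y = x≢y ∘ φ-inj _ _ vx vy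

  ladder-rung : ∀ {j} → 1 ≤ j → j < k → Rung N
  ladder-rung {j} 1≤j j<k = record
    { p₀ = φ (pp j) ; q₀ = φ (qq j) ; v₀ = φ (vv j)
    ; p₁ = φ (pp (suc j)) ; q₁ = φ (qq (suc j)) ; v₁ = φ (vv (suc j))
    ; ℓ₀ = lab j ; ℓ₁ = lab (suc j)
    ; p₀v₀ = P2-p j 1≤j j≤k ; q₀v₀ = P2-q j 1≤j j≤k
    ; p₁v₁ = P2-p (suc j) 1≤1+j j<k ; q₁v₁ = P2-q (suc j) 1≤1+j j<k
    ; q₁⇝q₀ = q-treePath 1≤j j<k
    ; q₀⇝p₁ = spine-treePath (spine-q→p 1≤j j<k) (pp-suc≢pp-1 1≤j)
    ; v₀⇝ℓ₀ = P1 j 1≤j j≤k ; v₁⇝ℓ₁ = P1 (suc j) 1≤1+j j<k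
    ; p₀≢q₀ = φ-distinct valid₀ valid₀ (λ ())
    ; p₁≢q₁ = φ-distinct valid₁ valid₁ (λ ())
    ; p₁≢q₀ = φ-distinct valid₁ valid₀ (λ ())
    ; p₁≢v₀ = φ-distinct valid₁ valid₀ (λ ())
    ; q₀≢q₁ = φ-distinct valid₀ valid₁ (λ ())
    ; q₀≢v₁ = φ-distinct valid₀ valid₁ (λ ())
    }
    where
      j≤k = <⇒≤ j<k
      1≤1+j = s≤s z≤n
      valid₀ = 1≤j , j≤k
      valid₁ = 1≤1+j , j<k

-- The paper excludes k = 2, but every step only uses the tree paths
-- q_{j+1} ⇝ q_j ⇝ p_{j+1}, which (P3↓) provides for every k.
lemma6 : ∀ {m n t : ℕ} (N : Network m n) → TreeChild N →
         (k : ℕ) → (k ≡ 1 ⊎ 3 ≤ k) →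
         (lab : ℕ → Fin m) (φ : LV → Fin n) → LooseLadder N k lab φ →
         (T : Network m t) → IsPhyloTree T →
         (E E′ : Embedding T N) →
         (∀ j → 1 ≤ j → j ≤ k → Uses E′ (φ (qq j)) (φ (vv j))) →
         Uses E (φ (pp k)) (φ (vv k)) →
         ∀ j → 1 ≤ j → j ≤ k ∸ 1 → Uses E (φ (pp j)) (φ (vv j))
lemma6 N tc k _ lab φ L T isT E E′ E′-uses-f E-uses-eₖ j 1≤j j≤k∸1 =
  downward-induction (λ i → 1 ≤ i → Uses E (φ (pp i)) (φ (vv i)))
    (λ _ → E-uses-eₖ)
    (λ i<k E-uses-next 1≤i →
       rung-step tc isT (ladder-rung L 1≤i i<k) E E′
         (E′-uses-f _ 1≤i (<⇒≤ i<k)) (E′-uses-f _ (s≤s z≤n) i<k) (E-uses-next (s≤s z≤n)))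
    (≤-trans j≤k∸1 (m∸n≤m k 1)) 1≤j
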